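{- Let $t\ge 1$ and let $p$ be a permutation of $\{1,\dots,n-1\}$ that is sorted by the left-greedy algorithm on $t$ stacks in series. If $p'$ is the permutation of $\{1,\dots,n\}$ obtained by inserting $n$ into one of the first $t$ positions of $p$ or into the last position of $p$, then $p'$ is also sorted by the left-greedy algorithm on $t$ stacks in series.
   Context: Sorting with $t$ stacks in series: the positions, ordered from right to left, are the input, stack $1$, ..., stack $t$, and the output. A permutation starts in the input, whose elements are taken in order from left to right. Legal moves: move the next input element onto the top of stack $1$; for $1\le k<t$ move the top of stack $k$ onto the top of stack $k+1$; move the top of stack $t$ to the output, allowed only if it is the smallest element not yet output. Moves into stacks are legal only if every stack remains increasing from top to bottom (smallest on top). A move is further left than another if its destination is further left. The left-greedy algorithm always performs the leftmost legal move. It fails if not all elements are output and no legal move exists; it sorts the permutation if it outputs all elements (in increasing order) without failing. Inserting $n$ into position $j$ of $p=p_1\cdots p_{n-1}$ means forming $p_1\cdots p_{j-1}\,n\,p_j\cdots p_{n-1}$. -}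

module Defs where

open import Data.Nat using (ℕ; zero; suc; _∸_; _≤ᵇ_; _<ᵇ_; _≤_)
open import Data.Bool using (Bool; true; false; _∧_; if_then_else_)
open import Data.List using (List; []; _∷_; _++_; [_]; concat; map; upTo; take; drop; length)
open import Data.List.Relation.Binary.Permutation.Propositional using (_↭_)
open import Data.Maybe using (Maybe; just; nothing)
open import Data.Product using (_×_; _,_; ∃)
open import Relation.Binary.PropositionalEquality using (_≡_)

allB : {A : Set} → (A → Bool) → List A → Bool
allB f [] = true
allB f (x ∷ xs) = f x ∧ allB f xs

IsPerm : ℕ → List ℕ → Set
IsPerm n p = p ↭ map suc (upTo n)

-- Configuration: remaining input (next element first), the stacks
-- (stack 1 first, each stack listed top first), and the output so far.
record Config : Set where
  constructor config
  field
    input  : List ℕ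
    stacks : List (List ℕ)
    output : List ℕ
open Config public

canPush : ℕ → List ℕ → Bool
canPush x []      = true
canPush x (y ∷ _) = x <ᵇ y

isSmallestRemaining : List ℕ → List (List ℕ) → ℕ → Bool
isSmallestRemaining inp sts x = allB (λ y → x ≤ᵇ y) (inp ++ concat sts)

outMove : (ℕ → Bool) → List (List ℕ) → Maybe (ℕ × List (List ℕ))
outMove ok []                = nothing
outMove ok ((x ∷ s) ∷ [])    = if ok x then just (x , s ∷ []) else nothing
outMove ok ([] ∷ [])         = nothing
outMove ok (s ∷ s₂ ∷ r) with outMove ok (s₂ ∷ r)
... | just (x , r') = just (x , s ∷ r')
... | nothing       = nothing

-- Leftmost legal move from stack k to stack k+1 (the pair with largest k first).
shift : List (List ℕ) → Maybe (List (List ℕ))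
shift [] = nothing
shift (s ∷ rest) with shift rest
... | just r  = just (s ∷ r)
... | nothing with s | rest
...   | x ∷ s' | s₂ ∷ r = if canPush x s₂ then just (s' ∷ (x ∷ s₂) ∷ r) else nothing
...   | _      | _      = nothing

inMove : List ℕ → List (List ℕ) → Maybe (List ℕ × List (List ℕ))
inMove (x ∷ inp) (s ∷ r) = if canPush x s then just (inp , (x ∷ s) ∷ r) else nothing
inMove _ _ = nothing

-- One step of the left-greedy algorithm: perform the leftmost legal move
-- (destination output, then stack t, …, then stack 1); nothing = no legal move.
greedyStep : Config → Maybe Config
greedyStep (config inp sts out)
  with outMove (isSmallestRemaining inp sts) sts
... | just (x , sts') = just (config inp sts' (out ++ [ x ]))
... | nothing with shift sts
...   | just sts' = just (config inp sts' out)
...   | nothing with inMove inp sts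
...     | just (inp' , sts') = just (config inp' sts' out)
...     | nothing = nothing

allOutput : Config → Bool
allOutput (config [] sts _) = allB (λ s → Data.List.null s) sts
allOutput (config (_ ∷ _) _ _) = false

runGreedy : ℕ → Config → Bool
runGreedy fuel c with allOutput c
runGreedy fuel c | true = true
runGreedy zero c | false = false
runGreedy (suc fuel) c | false with greedyStep c
... | just c' = runGreedy fuel c'
... | nothing = false

emptyStacks : ℕ → List (List ℕ)
emptyStacks zero = []
emptyStacks (suc t) = [] ∷ emptyStacks t

initConfig : ℕ → List ℕ → Config
initConfig t p = config p (emptyStacks t) []

GreedySortable : ℕ → List ℕ → Set
GreedySortable t p = ∃ λ fuel → runGreedy fuel (initConfig t p) ≡ true

-- insert a into position j (1-based) of p: p₁…p_{j-1} a p_j …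
insertAt : ℕ → ℕ → List ℕ → List ℕ
insertAt j a p = take (j ∸ 1) p ++ a ∷ drop (j ∸ 1) p

-- Write N = n + 1. The run on p′ makes exactly the moves of the run on p until it
-- has to read N: N exceeds every other element, so it never changes which element
-- is the smallest one remaining. N has to be read when the run on p would read the
-- element after N, or has finished; at that moment no output or stack-to-stack move
-- is legal. If N was inserted among the first t positions, fewer than t elements
-- have been read, so some stack is empty; as a non-empty stack followed by an empty
-- one would allow a stack-to-stack move, stack 1 is empty. If N was inserted last,
-- all other elements have been output. Either way N is pushed onto an empty stack 1.
-- From then on N lies at the bottom of a stack, where it blocks nothing (whatever
-- lands on it is smaller); it moves only when its stack and the next one are
-- otherwise empty, one stack to the right. So the run keeps mirroring the run on p,
-- interleaved with these moves of N, and N is output last.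

module Submission where

open import Defs
open import Data.Bool using (Bool; true; false; _∧_; if_then_else_; T)
open import Data.Bool.Properties using (∧-assoc; T-≡; ¬-not)
open import Data.Empty using (⊥-elim)
open import Data.List using (List; []; _∷_; _++_; [_]; concat; length; upTo; take; drop)
open import Data.List.Properties
  using (++-assoc; ++-identityʳ; ++-conicalˡ; ++-conicalʳ; length-++; length-map; length-upTo; length-drop;
         take++drop≡id; drop-all)
open import Data.List.Relation.Binary.Permutation.Propositional
  using (_↭_; ↭-refl; ↭-sym; ↭-trans; module PermutationReasoning)
open import Data.List.Relation.Binary.Permutation.Propositional.Properties
  using (++⁺ˡ; ++⁺ʳ; ∷↭∷ʳ; ↭-length; All-resp-↭) renaming (shift to ↭-shift)
open import Data.List.Relation.Unary.All using (All; []; _∷_)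
import Data.List.Relation.Unary.All as All
open import Data.List.Relation.Unary.All.Properties using (++⁺; ++⁻ˡ; ++⁻ʳ; concat⁺; concat⁻; map⁺; all-upTo)
open import Data.Maybe using (Maybe; just; nothing; _<∣>_)
import Data.Maybe as Maybe
open import Data.Maybe.Properties using (map-∘)
open import Data.Nat using (ℕ; zero; suc; _+_; _∸_; _≤_; _<_; _≤ᵇ_; z≤n; s≤s)
open import Data.Nat.Properties
  using (≤-refl; ≤-reflexive; ≤-trans; <⇒≤; n≮n; <⇒≱; <⇒≯; m≤n⇒m<n∨m≡n; 0≢1+n;
         ≤⇒≤ᵇ; ≤ᵇ⇒≤; <⇒<ᵇ; <ᵇ⇒<; +-suc; +-comm; m≤m+n; m≤n+m; m≤n+m∸n; m∸n+n≡m;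
         +-monoʳ-≤; +-monoʳ-<; module ≤-Reasoning)
open import Data.Product using (_×_; _,_; ∃; map₁; map₂; proj₂)
open import Data.Sum using (_⊎_; inj₁; inj₂)
import Data.Sum as Sum
open import Function using (_∘_; Equivalence)
open import Relation.Binary.PropositionalEquality hiding ([_])
open import Relation.Nullary using (¬_; contradiction)

allB-++ : ∀ (f : ℕ → Bool) xs ys → allB f (xs ++ ys) ≡ (allB f xs ∧ allB f ys)
allB-++ f []       ys = refl
allB-++ f (x ∷ xs) ys = trans (cong (f x ∧_) (allB-++ f xs ys)) (sym (∧-assoc (f x) _ _))

allB-insert : ∀ (f : ℕ → Bool) y → f y ≡ true → ∀ xs ys → allB f (xs ++ y ∷ ys) ≡ allB f (xs ++ ys)
allB-insert f y fy []       ys rewrite fy = refl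
allB-insert f y fy (x ∷ xs) ys = cong (f x ∧_) (allB-insert f y fy xs ys)

T⇒≡true : ∀ {b} → T b → b ≡ true
T⇒≡true = Equivalence.to T-≡

¬T⇒≡false : ∀ {b} → ¬ T b → b ≡ false
¬T⇒≡false ¬t = ¬-not (¬t ∘ Equivalence.from T-≡)

<-downward-rec : ∀ {t} (P : ℕ → Set) → (∀ {i} → i < t → (suc i < t → P (suc i)) → P i) →
                 ∀ {i} → i < t → P i
<-downward-rec {t} P below {i} i<t = go (t ∸ i) (m∸n+n≡m (<⇒≤ i<t)) i<t
  where
  go : ∀ k {i} → k + i ≡ t → i < t → P i
  go zero        refl i<t = contradiction i<t (n≮n _)
  go (suc k) {i} e    i<t = below i<t (go k (trans (+-suc k i) e))

shiftFirst : List ℕ → List (List ℕ) → Maybe (List (List ℕ))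
shiftFirst (x ∷ s) (s₂ ∷ r) = if canPush x s₂ then just (s ∷ (x ∷ s₂) ∷ r) else nothing
shiftFirst _       _        = nothing

shift-∷ : ∀ s r → shift (s ∷ r) ≡ (Maybe.map (s ∷_) (shift r) <∣> shiftFirst s r)
shift-∷ s r with shift r
... | just _  = refl
... | nothing with s | r
...   | []    | _     = refl
...   | _ ∷ _ | []    = refl
...   | _ ∷ _ | _ ∷ _ = refl

outMove-∷ : ∀ ok s r → r ≢ [] → outMove ok (s ∷ r) ≡ Maybe.map (map₂ (s ∷_)) (outMove ok r)
outMove-∷ ok s       []       r≢[] = ⊥-elim (r≢[] refl)
outMove-∷ ok []      (s₂ ∷ r) _ with outMove ok (s₂ ∷ r)
... | just (_ , _) = refl
... | nothing      = refl
outMove-∷ ok (_ ∷ _) (s₂ ∷ r) _ with outMove ok (s₂ ∷ r)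
... | just (_ , _) = refl
... | nothing      = refl

outMove-cong : ∀ {P : ℕ → Set} {ok₁ ok₂ : ℕ → Bool} → (∀ {x} → P x → ok₁ x ≡ ok₂ x) →
               ∀ {sts} → All (All P) sts → outMove ok₁ sts ≡ outMove ok₂ sts
outMove-cong h []              = refl
outMove-cong h ([] ∷ [])       = refl
outMove-cong h ((px ∷ _) ∷ []) rewrite h px = refl
outMove-cong {ok₁ = ok₁} {ok₂} h {s ∷ s₂ ∷ r} (_ ∷ bs) = begin
  outMove ok₁ (s ∷ s₂ ∷ r)                       ≡⟨ outMove-∷ ok₁ s (s₂ ∷ r) (λ ()) ⟩
  Maybe.map (map₂ (s ∷_)) (outMove ok₁ (s₂ ∷ r)) ≡⟨ cong (Maybe.map _) (outMove-cong h bs) ⟩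
  Maybe.map (map₂ (s ∷_)) (outMove ok₂ (s₂ ∷ r)) ≡⟨ outMove-∷ ok₂ s (s₂ ∷ r) (λ ()) ⟨
  outMove ok₂ (s ∷ s₂ ∷ r)                       ∎
  where open ≡-Reasoning

data Move : Config → Config → Set where
  emit : ∀ {inp sts out x sts′} →
         outMove (isSmallestRemaining inp sts) sts ≡ just (x , sts′) →
         Move (config inp sts out) (config inp sts′ (out ++ [ x ]))
  pass : ∀ {inp sts out sts′} →
         outMove (isSmallestRemaining inp sts) sts ≡ nothing → shift sts ≡ just sts′ →
         Move (config inp sts out) (config inp sts′ out)
  push : ∀ {x inp s r out} →
         outMove (isSmallestRemaining (x ∷ inp) (s ∷ r)) (s ∷ r) ≡ nothing → shift (s ∷ r) ≡ nothing →
         canPush x s ≡ true →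
         Move (config (x ∷ inp) (s ∷ r) out) (config inp ((x ∷ s) ∷ r) out)

Move⇒greedyStep : ∀ {c d} → Move c d → greedyStep c ≡ just d
Move⇒greedyStep (emit eO)       rewrite eO           = refl
Move⇒greedyStep (pass eO eS)    rewrite eO | eS      = refl
Move⇒greedyStep (push eO eS ep) rewrite eO | eS | ep = refl

greedyStep⇒Move : ∀ {c d} → greedyStep c ≡ just d → Move c d
greedyStep⇒Move {config inp sts out} e with outMove (isSmallestRemaining inp sts) sts in eO
... | just (x , sts′) with refl ← e = emit eO
... | nothing with shift sts in eS
...   | just sts′ with refl ← e = pass eO eS
...   | nothing with inMove inp sts in eI
...     | just (inp′ , sts′) with refl ← e = inMove⇒push eO eS eI
  where
  inMove⇒push : ∀ {inp sts inp′ sts′} →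
    outMove (isSmallestRemaining inp sts) sts ≡ nothing → shift sts ≡ nothing →
    inMove inp sts ≡ just (inp′ , sts′) → Move (config inp sts out) (config inp′ sts′ out)
  inMove⇒push {x ∷ inp} {s ∷ r} eO eS eI with canPush x s in ep
  inMove⇒push {x ∷ inp} {s ∷ r} eO eS refl | true = push eO eS ep

data Sorts : Config → Set where
  finished : ∀ {c} → allOutput c ≡ true → Sorts c
  step     : ∀ {c d} → Move c d → Sorts d → Sorts c

runGreedy⇒Sorts : ∀ fuel c → runGreedy fuel c ≡ true → Sorts c
runGreedy⇒Sorts fuel c r with allOutput c in done
... | true = finished done
runGreedy⇒Sorts (suc fuel) c r | false with greedyStep c in e
... | just d = step (greedyStep⇒Move e) (runGreedy⇒Sorts fuel d r)

Sorts⇒runGreedy : ∀ {c} → Sorts c → ∃ λ fuel → runGreedy fuel c ≡ true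
Sorts⇒runGreedy {c} (finished done) = 0 , run-done
  where
  run-done : runGreedy 0 c ≡ true
  run-done rewrite done = refl
Sorts⇒runGreedy {c} (step m s) with Sorts⇒runGreedy s
... | fuel , r = suc fuel , run-step
  where
  run-step : runGreedy (suc fuel) c ≡ true
  run-step with allOutput c
  ... | true  = refl
  ... | false rewrite Move⇒greedyStep m = r

contents : Config → List ℕ
contents (config inp sts out) = inp ++ concat sts ++ out

shiftFirst-↭ : ∀ s r {sts′} → shiftFirst s r ≡ just sts′ → concat (s ∷ r) ↭ concat sts′
shiftFirst-↭ (x ∷ s) (s₂ ∷ r) e with canPush x s₂
shiftFirst-↭ (x ∷ s) (s₂ ∷ r) refl | true = ↭-sym (↭-shift x s (s₂ ++ concat r))

shift-↭ : ∀ sts {sts′} → shift sts ≡ just sts′ → concat sts ↭ concat sts′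
shift-↭ (s ∷ r) e with shift r in eʳ | trans (sym (shift-∷ s r)) e
... | just _  | refl = ++⁺ˡ s (shift-↭ r eʳ)
... | nothing | e′   = shiftFirst-↭ s r e′

outMove-↭ : ∀ ok sts {x sts′} → outMove ok sts ≡ just (x , sts′) → concat sts ↭ x ∷ concat sts′
outMove-↭ ok ((y ∷ s) ∷ []) e with ok y
outMove-↭ ok ((y ∷ s) ∷ []) refl | true = ↭-refl
outMove-↭ ok (s ∷ s₂ ∷ r) e with outMove ok (s₂ ∷ r) in eʳ | trans (sym (outMove-∷ ok s (s₂ ∷ r) λ ())) e
... | just (x , r′) | refl = ↭-trans (++⁺ˡ s (outMove-↭ ok (s₂ ∷ r) eʳ)) (↭-shift x s (concat r′))

move-↭ : ∀ {c d} → Move c d → contents c ↭ contents d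
move-↭ (emit {inp} {sts} {out} {x} {sts′} eO) = ++⁺ˡ inp (begin
  concat sts ++ out               ↭⟨ ++⁺ʳ out (outMove-↭ _ sts eO) ⟩
  x ∷ concat sts′ ++ out          ↭⟨ ∷↭∷ʳ x _ ⟩
  (concat sts′ ++ out) ++ [ x ]   ≡⟨ ++-assoc (concat sts′) out [ x ] ⟩
  concat sts′ ++ out ++ [ x ]     ∎)
  where open PermutationReasoning
move-↭ (pass {inp} {sts} {out} _ eS)          = ++⁺ˡ inp (++⁺ʳ out (shift-↭ sts eS))
move-↭ (push {x} {inp} {s} {r} {out} _ _ _)   = ↭-sym (↭-shift x inp ((s ++ concat r) ++ out))

shiftFirst-length : ∀ s r {sts′} → shiftFirst s r ≡ just sts′ → length sts′ ≡ length (s ∷ r)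
shiftFirst-length (x ∷ s) (s₂ ∷ r) e with canPush x s₂
shiftFirst-length (x ∷ s) (s₂ ∷ r) refl | true = refl

shift-length : ∀ sts {sts′} → shift sts ≡ just sts′ → length sts′ ≡ length sts
shift-length (s ∷ r) e with shift r in eʳ | trans (sym (shift-∷ s r)) e
... | just _  | refl = cong suc (shift-length r eʳ)
... | nothing | e′   = shiftFirst-length s r e′

outMove-length : ∀ ok sts {x sts′} → outMove ok sts ≡ just (x , sts′) → length sts′ ≡ length sts
outMove-length ok ((y ∷ s) ∷ []) e with ok y
outMove-length ok ((y ∷ s) ∷ []) refl | true = refl
outMove-length ok (s ∷ s₂ ∷ r) e with outMove ok (s₂ ∷ r) in eʳ | trans (sym (outMove-∷ ok s (s₂ ∷ r) λ ())) e
... | just (x , r′) | refl = cong suc (outMove-length ok (s₂ ∷ r) eʳ)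

move-length : ∀ {c d} → Move c d → length (stacks d) ≡ length (stacks c)
move-length (emit {sts = sts} eO)   = outMove-length _ sts eO
move-length (pass {sts = sts} _ eS) = shift-length sts eS
move-length (push _ _ _)            = refl

outMove-concat≡[] : ∀ ok sts → concat sts ≡ [] → outMove ok sts ≡ nothing
outMove-concat≡[] ok []            _ = refl
outMove-concat≡[] ok ([] ∷ [])     _ = refl
outMove-concat≡[] ok ([] ∷ s₂ ∷ r) e =
  trans (outMove-∷ ok [] (s₂ ∷ r) λ ()) (cong (Maybe.map _) (outMove-concat≡[] ok (s₂ ∷ r) e))

shift-concat≡[] : ∀ sts → concat sts ≡ [] → shift sts ≡ nothing
shift-concat≡[] []       _ = refl
shift-concat≡[] ([] ∷ r) e =
  trans (shift-∷ [] r) (cong (λ m → Maybe.map ([] ∷_) m <∣> nothing) (shift-concat≡[] r e))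

move-remaining≢[] : ∀ {c d} → Move c d → input c ++ concat (stacks c) ≢ []
move-remaining≢[] (emit {inp} {sts} eO) e =
  0≢1+n (trans (cong length (sym (++-conicalʳ inp (concat sts) e))) (↭-length (outMove-↭ _ sts eO)))
move-remaining≢[] (pass {inp} {sts} _ eS) e
  with () ← trans (sym eS) (shift-concat≡[] sts (++-conicalʳ inp (concat sts) e))
move-remaining≢[] (push _ _ _) ()

concat-emptyStacks : ∀ t → concat (emptyStacks t) ≡ []
concat-emptyStacks zero    = refl
concat-emptyStacks (suc t) = concat-emptyStacks t

length-emptyStacks : ∀ t → length (emptyStacks t) ≡ t
length-emptyStacks zero    = refl
length-emptyStacks (suc t) = cong suc (length-emptyStacks t)

contents-initConfig : ∀ t p → contents (initConfig t p) ≡ p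
contents-initConfig t p = trans (cong (λ xs → p ++ xs ++ []) (concat-emptyStacks t)) (++-identityʳ p)

allOutput-emptyStacks : ∀ t out → allOutput (config [] (emptyStacks t) out) ≡ true
allOutput-emptyStacks zero    out = refl
allOutput-emptyStacks (suc t) out = allOutput-emptyStacks t out

allOutput⇒emptyStacks : ∀ inp sts {out} → allOutput (config inp sts out) ≡ true →
                        inp ≡ [] × sts ≡ emptyStacks (length sts)
allOutput⇒emptyStacks [] []               _ = refl , refl
allOutput⇒emptyStacks [] ([] ∷ sts) {out} e = refl , cong ([] ∷_) (proj₂ (allOutput⇒emptyStacks [] sts {out} e))

shift-stuck⇒nonempty : ∀ s r → shift (s ∷ r) ≡ nothing → s ≢ [] → All (_≢ []) (s ∷ r)
shift-stuck⇒nonempty s []       _ s≢[] = s≢[] ∷ []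
shift-stuck⇒nonempty s (s₂ ∷ r) e s≢[] with shift (s₂ ∷ r) in eʳ | trans (sym (shift-∷ s (s₂ ∷ r))) e
... | nothing | e′ = s≢[] ∷ shift-stuck⇒nonempty s₂ r eʳ (next-nonempty s s₂ s≢[] e′)
  where
  next-nonempty : ∀ s s₂ → s ≢ [] → shiftFirst s (s₂ ∷ r) ≡ nothing → s₂ ≢ []
  next-nonempty []      _       s≢[] _ = ⊥-elim (s≢[] refl)
  next-nonempty (_ ∷ _) []      _    ()
  next-nonempty (_ ∷ _) (_ ∷ _) _    _ ()

length≤length-concat : ∀ {sts : List (List ℕ)} → All (_≢ []) sts → length sts ≤ length (concat sts)
length≤length-concat []                         = z≤n
length≤length-concat {[] ∷ _}       (s≢[] ∷ _)  = ⊥-elim (s≢[] refl)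
length≤length-concat {(_ ∷ s) ∷ _}  (_ ∷ ne)    =
  s≤s (≤-trans (length≤length-concat ne) (≤-trans (m≤n+m _ (length s)) (≤-reflexive (sym (length-++ s)))))

-- With N inserted in front of b, length (contents c) ∸ length b elements precede
-- N; they must be fewer than the t stacks, unless N comes last.
ShortPrefix : ℕ → List ℕ → Config → Set
ShortPrefix t b c = length (contents c) < length b + t ⊎ b ≡ []

shift-stuck⇒¬ShortPrefix : ∀ {t b s r out} → length (s ∷ r) ≡ t → shift (s ∷ r) ≡ nothing → s ≢ [] → b ≢ [] →
                           ¬ ShortPrefix t b (config b (s ∷ r) out)
shift-stuck⇒¬ShortPrefix {t} {b} {s} {r} {out} len eS s≢[] _ (inj₁ short) = n≮n _ (begin-strict
  length b + t                                        ≡⟨ cong (length b +_) len ⟨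
  length b + length (s ∷ r)                           ≤⟨ +-monoʳ-≤ (length b) stacked ⟩
  length b + (length (concat (s ∷ r)) + length out)   ≡⟨ length-contents ⟨
  length (contents (config b (s ∷ r) out))            <⟨ short ⟩
  length b + t                                        ∎)
  where
  open ≤-Reasoning
  stacked : length (s ∷ r) ≤ length (concat (s ∷ r)) + length out
  stacked = ≤-trans (length≤length-concat (shift-stuck⇒nonempty s r eS s≢[])) (m≤m+n _ (length out))
  length-contents : length (contents (config b (s ∷ r) out)) ≡ length b + (length (concat (s ∷ r)) + length out)
  length-contents = trans (length-++ b) (cong (length b +_) (length-++ (concat (s ∷ r))))
shift-stuck⇒¬ShortPrefix _ _ _ b≢[] (inj₂ b≡[]) = b≢[] b≡[]

shortPrefix-initConfig : ∀ {t n j} p → length p ≡ n → (suc j ≤ t ⊎ suc j ≡ suc n) →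
                         ShortPrefix t (drop j p) (initConfig t p)
shortPrefix-initConfig {t} {j = j} p refl (inj₁ j<t) = inj₁ (begin-strict
  length (contents (initConfig t p)) ≡⟨ cong length (contents-initConfig t p) ⟩
  length p                           ≤⟨ m≤n+m∸n (length p) j ⟩
  j + (length p ∸ j)                 ≡⟨ +-comm j (length p ∸ j) ⟩
  (length p ∸ j) + j                 <⟨ +-monoʳ-< (length p ∸ j) j<t ⟩
  (length p ∸ j) + t                 ≡⟨ cong (_+ t) (length-drop j p) ⟨
  length (drop j p) + t              ∎)
  where open ≤-Reasoning
shortPrefix-initConfig {j = j} p refl (inj₂ refl) = inj₂ (drop-all j p ≤-refl)

module Largest (N : ℕ) where

  record Bounded (c : Config) : Set where
    constructor bounded
    field below : All (_< N) (contents c)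

  Bounded⇒input : ∀ {inp sts out} → Bounded (config inp sts out) → All (_< N) inp
  Bounded⇒input {inp} (bounded b) = ++⁻ˡ inp b

  Bounded⇒stacks : ∀ {inp sts out} → Bounded (config inp sts out) → All (All (_< N)) sts
  Bounded⇒stacks {inp} {sts} (bounded b) = concat⁻ (++⁻ˡ (concat sts) (++⁻ʳ inp b))

  Bounded-move : ∀ {c d} → Move c d → Bounded c → Bounded d
  Bounded-move m (bounded b) = bounded (All-resp-↭ (move-↭ m) b)

  Bounded-initConfig : ∀ t {p} → All (_< N) p → Bounded (initConfig t p)
  Bounded-initConfig t {p} b = bounded (subst (All (_< N)) (sym (contents-initConfig t p)) b)

  canPush-appendN : ∀ {x} → x < N → ∀ s → canPush x (s ++ [ N ]) ≡ canPush x s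
  canPush-appendN x<N []      = T⇒≡true (<⇒<ᵇ x<N)
  canPush-appendN x<N (_ ∷ _) = refl

  canPush-N : ∀ {y} → y < N → ∀ s → canPush N (y ∷ s) ≡ false
  canPush-N {y} y<N s = ¬T⇒≡false (<⇒≯ y<N ∘ <ᵇ⇒< N y)

  smallest-inInput : ∀ {y} → y ≤ N → ∀ a b sts →
    isSmallestRemaining (a ++ N ∷ b) sts y ≡ isSmallestRemaining (a ++ b) sts y
  smallest-inInput {y} y≤N a b sts rewrite ++-assoc a (N ∷ b) (concat sts) | ++-assoc a b (concat sts) =
    allB-insert (y ≤ᵇ_) N (T⇒≡true (≤⇒≤ᵇ y≤N)) a (b ++ concat sts)

  N-not-smallest : ∀ inp sts → All (_< N) (inp ++ concat sts) → inp ++ concat sts ≢ [] →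
    isSmallestRemaining inp sts N ≡ false
  N-not-smallest inp sts bnd nonempty with inp ++ concat sts
  ... | []     = ⊥-elim (nonempty refl)
  ... | y ∷ ys with y<N ∷ _ ← bnd rewrite ¬T⇒≡false (<⇒≱ y<N ∘ ≤ᵇ⇒≤ N y) = refl

  -- N at the bottom of a stack

  insertBottom : ℕ → List (List ℕ) → List (List ℕ)
  insertBottom i       []      = []
  insertBottom zero    (s ∷ r) = (s ++ [ N ]) ∷ r
  insertBottom (suc i) (s ∷ r) = s ∷ insertBottom i r

  inStack : ℕ → Config → Config
  inStack i (config inp sts out) = config inp (insertBottom i sts) out

  insertBottom-≢[] : ∀ i s r → insertBottom i (s ∷ r) ≢ []
  insertBottom-≢[] zero    _ _ ()
  insertBottom-≢[] (suc i) _ _ ()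

  allB-concat-insertBottom : ∀ f → f N ≡ true → ∀ i sts → allB f (concat (insertBottom i sts)) ≡ allB f (concat sts)
  allB-concat-insertBottom f fN i       []      = refl
  allB-concat-insertBottom f fN zero    (s ∷ r) =
    trans (cong (allB f) (++-assoc s [ N ] (concat r))) (allB-insert f N fN s (concat r))
  allB-concat-insertBottom f fN (suc i) (s ∷ r) = begin
    allB f (s ++ concat (insertBottom i r))       ≡⟨ allB-++ f s (concat (insertBottom i r)) ⟩
    allB f s ∧ allB f (concat (insertBottom i r)) ≡⟨ cong (allB f s ∧_) (allB-concat-insertBottom f fN i r) ⟩
    allB f s ∧ allB f (concat r)                  ≡⟨ allB-++ f s (concat r) ⟨
    allB f (s ++ concat r)                        ∎
    where open ≡-Reasoning

  smallest-insertBottom : ∀ {y} → y ≤ N → ∀ inp i sts →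
    isSmallestRemaining inp (insertBottom i sts) y ≡ isSmallestRemaining inp sts y
  smallest-insertBottom {y} y≤N inp i sts = begin
    allB (y ≤ᵇ_) (inp ++ concat (insertBottom i sts))             ≡⟨ allB-++ (y ≤ᵇ_) inp (concat (insertBottom i sts)) ⟩
    allB (y ≤ᵇ_) inp ∧ allB (y ≤ᵇ_) (concat (insertBottom i sts)) ≡⟨ cong (allB (y ≤ᵇ_) inp ∧_) stacks-eq ⟩
    allB (y ≤ᵇ_) inp ∧ allB (y ≤ᵇ_) (concat sts)                  ≡⟨ allB-++ (y ≤ᵇ_) inp (concat sts) ⟨
    allB (y ≤ᵇ_) (inp ++ concat sts)                              ∎
    where
    open ≡-Reasoning
    stacks-eq : allB (y ≤ᵇ_) (concat (insertBottom i sts)) ≡ allB (y ≤ᵇ_) (concat sts)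
    stacks-eq = allB-concat-insertBottom (y ≤ᵇ_) (T⇒≡true (≤⇒≤ᵇ y≤N)) i sts

  outMove-insertBottom : ∀ ok → ok N ≡ false → ∀ i sts →
    outMove ok (insertBottom i sts) ≡ Maybe.map (map₂ (insertBottom i)) (outMove ok sts)
  outMove-insertBottom ok okN i       []             = refl
  outMove-insertBottom ok okN zero    ([] ∷ [])      rewrite okN = refl
  outMove-insertBottom ok okN zero    ((x ∷ s) ∷ []) with ok x
  ... | true  = refl
  ... | false = refl
  outMove-insertBottom ok okN (suc i) ([] ∷ [])      = refl
  outMove-insertBottom ok okN (suc i) ((x ∷ s) ∷ []) with ok x
  ... | true  = refl
  ... | false = refl
  outMove-insertBottom ok okN zero    (s ∷ s₂ ∷ r)   =
    trans (outMove-∷ ok (s ++ [ N ]) (s₂ ∷ r) λ ())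
          (trans (map-∘ (outMove ok (s₂ ∷ r))) (cong (Maybe.map _) (sym (outMove-∷ ok s (s₂ ∷ r) λ ()))))
  outMove-insertBottom ok okN (suc i) (s ∷ s₂ ∷ r)   = begin
    outMove ok (s ∷ insertBottom i (s₂ ∷ r))
      ≡⟨ outMove-∷ ok s _ (insertBottom-≢[] i s₂ r) ⟩
    Maybe.map (map₂ (s ∷_)) (outMove ok (insertBottom i (s₂ ∷ r)))
      ≡⟨ cong (Maybe.map _) (outMove-insertBottom ok okN i (s₂ ∷ r)) ⟩
    Maybe.map (map₂ (s ∷_)) (Maybe.map (map₂ (insertBottom i)) (outMove ok (s₂ ∷ r)))
      ≡⟨ trans (sym (map-∘ (outMove ok (s₂ ∷ r)))) (map-∘ (outMove ok (s₂ ∷ r))) ⟩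
    Maybe.map (map₂ (insertBottom (suc i))) (Maybe.map (map₂ (s ∷_)) (outMove ok (s₂ ∷ r)))
      ≡⟨ cong (Maybe.map _) (outMove-∷ ok s (s₂ ∷ r) λ ()) ⟨
    Maybe.map (map₂ (insertBottom (suc i))) (outMove ok (s ∷ s₂ ∷ r))
      ∎
    where open ≡-Reasoning

  shiftFirst-insertBottom : ∀ {s} → All (_< N) s → ∀ i r →
    shiftFirst s (insertBottom i r) ≡ Maybe.map (insertBottom (suc i)) (shiftFirst s r)
  shiftFirst-insertBottom []                i       []       = refl
  shiftFirst-insertBottom []                i       (_ ∷ _)  = refl
  shiftFirst-insertBottom (_ ∷ _)           i       []       = refl
  shiftFirst-insertBottom {x ∷ _} (x<N ∷ _) zero    (s₂ ∷ r) rewrite canPush-appendN x<N s₂ with canPush x s₂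
  ... | true  = refl
  ... | false = refl
  shiftFirst-insertBottom {x ∷ _} _         (suc i) (s₂ ∷ r) with canPush x s₂
  ... | true  = refl
  ... | false = refl

  shiftFirst-appendN : ∀ s r → All (All (_< N)) r →
    shiftFirst (s ++ [ N ]) r ≡ Maybe.map (insertBottom 0) (shiftFirst s r)
    ⊎ (shiftFirst (s ++ [ N ]) r ≡ just (insertBottom 1 (s ∷ r)) × 1 < length (s ∷ r))
  shiftFirst-appendN (x ∷ s) []             _ = inj₁ refl
  shiftFirst-appendN (x ∷ s) (s₂ ∷ r)       _ with canPush x s₂
  ... | true  = inj₁ refl
  ... | false = inj₁ refl
  shiftFirst-appendN []      []             _ = inj₁ refl
  shiftFirst-appendN []      ([] ∷ r)       _ = inj₂ (refl , s≤s (s≤s z≤n))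
  shiftFirst-appendN []      ((y ∷ s₂) ∷ r) ((y<N ∷ _) ∷ _) rewrite canPush-N y<N s₂ = inj₁ refl

  shift-insertBottom : ∀ i sts → All (All (_< N)) sts → i < length sts →
    shift (insertBottom i sts) ≡ Maybe.map (insertBottom i) (shift sts)
    ⊎ (shift (insertBottom i sts) ≡ just (insertBottom (suc i) sts) × suc i < length sts)
  shift-insertBottom zero    (s ∷ r) (_ ∷ bs) _ rewrite shift-∷ (s ++ [ N ]) r | shift-∷ s r with shift r
  ... | just _  = inj₁ refl
  ... | nothing = shiftFirst-appendN s r bs
  shift-insertBottom (suc i) (s ∷ r) (b ∷ bs) (s≤s i<)
    rewrite shift-∷ s (insertBottom i r) | shift-∷ s r with shift-insertBottom i r bs i<
  ... | inj₂ (e , lt) rewrite e = inj₂ (refl , s≤s lt)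
  ... | inj₁ e rewrite e with shift r
  ...   | just _  = inj₁ refl
  ...   | nothing = inj₁ (shiftFirst-insertBottom b i r)

  outMove-inStack : ∀ {inp sts out} i → Bounded (config inp sts out) → inp ++ concat sts ≢ [] →
    outMove (isSmallestRemaining inp (insertBottom i sts)) (insertBottom i sts)
    ≡ Maybe.map (map₂ (insertBottom i)) (outMove (isSmallestRemaining inp sts) sts)
  outMove-inStack {inp} {sts} i b nonempty = begin
    outMove ok′ (insertBottom i sts)                    ≡⟨ outMove-insertBottom ok′ ok′N i sts ⟩
    Maybe.map (map₂ (insertBottom i)) (outMove ok′ sts) ≡⟨ cong (Maybe.map _) (outMove-cong agree (Bounded⇒stacks b)) ⟩
    Maybe.map (map₂ (insertBottom i)) (outMove ok sts)  ∎
    where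
    open ≡-Reasoning
    ok ok′ : ℕ → Bool
    ok  = isSmallestRemaining inp sts
    ok′ = isSmallestRemaining inp (insertBottom i sts)
    agree : ∀ {x} → x < N → ok′ x ≡ ok x
    agree x<N = smallest-insertBottom (<⇒≤ x<N) inp i sts
    ok′N : ok′ N ≡ false
    ok′N = trans (smallest-insertBottom ≤-refl inp i sts)
                 (N-not-smallest inp sts (++⁺ (Bounded⇒input b) (concat⁺ (Bounded⇒stacks b))) nonempty)

  push-inStack : ∀ {x inp s r out} i → x < N → canPush x s ≡ true →
    outMove (isSmallestRemaining (x ∷ inp) (insertBottom i (s ∷ r))) (insertBottom i (s ∷ r)) ≡ nothing →
    shift (insertBottom i (s ∷ r)) ≡ nothing →
    Move (inStack i (config (x ∷ inp) (s ∷ r) out)) (inStack i (config inp ((x ∷ s) ∷ r) out))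
  push-inStack {s = s} zero    x<N ep eO eS = push eO eS (trans (canPush-appendN x<N s) ep)
  push-inStack         (suc i) _   ep eO eS = push eO eS ep

  move-inStack : ∀ {c d} i → Bounded c → i < length (stacks c) → Move c d →
    Move (inStack i c) (inStack i d) ⊎ (Move (inStack i c) (inStack (suc i) c) × suc i < length (stacks c))
  move-inStack {config inp sts out} i b i< m with outMove-inStack i b (move-remaining≢[] m)
  ... | eO′ with m
  ...   | emit eO       = inj₁ (emit (trans eO′ (cong (Maybe.map _) eO)))
  ...   | pass eO eS    =
    let eO″ = trans eO′ (cong (Maybe.map _) eO) in
    Sum.map (λ e → pass eO″ (trans e (cong (Maybe.map _) eS))) (map₁ (pass eO″))
            (shift-insertBottom i sts (Bounded⇒stacks b) i<)
  ...   | push eO eS ep =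
    let eO″ = trans eO′ (cong (Maybe.map _) eO) in
    Sum.map (λ e → push-inStack i (All.head (Bounded⇒input b)) ep eO″ (trans e (cong (Maybe.map _) eS)))
            (map₁ (pass eO″))
            (shift-insertBottom i sts (Bounded⇒stacks b) i<)

  smallest-lone : ∀ i t → isSmallestRemaining [] (insertBottom i (emptyStacks t)) N ≡ true
  smallest-lone i t = begin
    isSmallestRemaining [] (insertBottom i (emptyStacks t)) N ≡⟨ smallest-insertBottom ≤-refl [] i (emptyStacks t) ⟩
    allB (N ≤ᵇ_) (concat (emptyStacks t))                     ≡⟨ cong (allB (N ≤ᵇ_)) (concat-emptyStacks t) ⟩
    true                                                      ∎
    where open ≡-Reasoning

  outMove-lone : ∀ ok i t → suc i < t → outMove ok (insertBottom i (emptyStacks t)) ≡ nothing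
  outMove-lone ok zero    (suc (suc t)) _          =
    trans (outMove-∷ ok [ N ] (emptyStacks (suc t)) (λ ()))
          (cong (Maybe.map _) (outMove-concat≡[] ok (emptyStacks (suc t)) (concat-emptyStacks (suc t))))
  outMove-lone ok zero    (suc zero)    (s≤s ())
  outMove-lone ok (suc i) (suc (suc t)) (s≤s si<t) =
    trans (outMove-∷ ok [] _ (insertBottom-≢[] i [] (emptyStacks t)))
          (cong (Maybe.map _) (outMove-lone ok i (suc t) si<t))

  outMove-lone-last : ∀ ok → ok N ≡ true → ∀ i →
    outMove ok (insertBottom i (emptyStacks (suc i))) ≡ just (N , emptyStacks (suc i))
  outMove-lone-last ok okN zero    rewrite okN = refl
  outMove-lone-last ok okN (suc i) =
    trans (outMove-∷ ok [] _ (insertBottom-≢[] i [] (emptyStacks i)))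
          (cong (Maybe.map _) (outMove-lone-last ok okN i))

  shift-lone : ∀ i t → suc i < t → shift (insertBottom i (emptyStacks t)) ≡ just (insertBottom (suc i) (emptyStacks t))
  shift-lone zero    (suc (suc t)) _          =
    trans (shift-∷ [ N ] (emptyStacks (suc t)))
          (cong (λ m → Maybe.map ([ N ] ∷_) m <∣> shiftFirst [ N ] (emptyStacks (suc t)))
                (shift-concat≡[] (emptyStacks (suc t)) (concat-emptyStacks (suc t))))
  shift-lone zero    (suc zero)    (s≤s ())
  shift-lone (suc i) (suc (suc t)) (s≤s si<t) =
    trans (shift-∷ [] (insertBottom i (emptyStacks (suc t))))
          (cong (λ m → Maybe.map ([] ∷_) m <∣> nothing) (shift-lone i (suc t) si<t))

  sorts-lone : ∀ {t} out {i} → i < t → Sorts (inStack i (config [] (emptyStacks t) out))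
  sorts-lone {t} out = <-downward-rec (λ i → Sorts (inStack i (config [] (emptyStacks t) out))) lone-step
    where
    lone-step : ∀ {i} → i < t → (suc i < t → Sorts (inStack (suc i) (config [] (emptyStacks t) out))) →
                Sorts (inStack i (config [] (emptyStacks t) out))
    lone-step {i} i<t further with m≤n⇒m<n∨m≡n i<t
    ... | inj₁ si<t = step (pass (outMove-lone _ i t si<t) (shift-lone i t si<t)) (further si<t)
    ... | inj₂ refl = step (emit (outMove-lone-last _ (smallest-lone i (suc i)) i))
                           (finished (allOutput-emptyStacks (suc i) (out ++ [ N ])))

  sorts-inStack : ∀ {c} → Sorts c → Bounded c → ∀ {i} → i < length (stacks c) → Sorts (inStack i c)
  sorts-inStack {config inp sts out} (finished done) _ {i} i< with allOutput⇒emptyStacks inp sts done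
  ... | refl , sts≡ = subst (λ sts → Sorts (inStack i (config [] sts out))) (sym sts≡) (sorts-lone out i<)
  sorts-inStack {c} (step m s) b = <-downward-rec (λ i → Sorts (inStack i c)) next-step
    where
    next-step : ∀ {i} → i < length (stacks c) → (suc i < length (stacks c) → Sorts (inStack (suc i) c)) →
                Sorts (inStack i c)
    next-step {i} i< further with move-inStack i b i< m
    ... | inj₁ m′        = step m′ (sorts-inStack s (Bounded-move m b) (subst (i <_) (sym (move-length m)) i<))
    ... | inj₂ (m′ , lt) = step m′ (further lt)

  -- N in the input

  outMove-inInput : ∀ a b {sts out} → Bounded (config (a ++ b) sts out) →
    outMove (isSmallestRemaining (a ++ N ∷ b) sts) sts ≡ outMove (isSmallestRemaining (a ++ b) sts) sts
  outMove-inInput a b {sts} bc = outMove-cong (λ x<N → smallest-inInput (<⇒≤ x<N) a b sts) (Bounded⇒stacks bc)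

  move-inInput : ∀ {c d} a b → Move c d → input c ≡ a ++ b → Bounded c →
    (∃ λ a′ → input d ≡ a′ ++ b
            × Move (config (a ++ N ∷ b) (stacks c) (output c)) (config (a′ ++ N ∷ b) (stacks d) (output d)))
    ⊎ (a ≡ [] × b ≢ [] × outMove (isSmallestRemaining (input c) (stacks c)) (stacks c) ≡ nothing
                       × shift (stacks c) ≡ nothing)
  move-inInput a       b (emit eO)       refl bc = inj₁ (a , refl , emit (trans (outMove-inInput a b bc) eO))
  move-inInput a       b (pass eO eS)    refl bc = inj₁ (a , refl , pass (trans (outMove-inInput a b bc) eO) eS)
  move-inInput (x ∷ a) b (push eO eS ep) refl bc =
    inj₁ (a , refl , push (trans (outMove-inInput (x ∷ a) b bc) eO) eS ep)
  move-inInput []      b (push eO eS ep) refl bc = inj₂ (refl , (λ ()) , eO , eS)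

  sorts-lone-input : ∀ {t} out → 0 < t → Sorts (config [ N ] (emptyStacks t) out)
  sorts-lone-input {suc t} out _ =
    step (push (outMove-concat≡[] _ ([] ∷ emptyStacks t) (concat-emptyStacks t))
               (shift-concat≡[] ([] ∷ emptyStacks t) (concat-emptyStacks t)) refl)
         (sorts-lone out (s≤s z≤n))

  sorts-N-next : ∀ {t b sts out} → 0 < t → Sorts (config b sts out) → Bounded (config b sts out) →
    length sts ≡ t → ShortPrefix t b (config b sts out) → b ≢ [] →
    outMove (isSmallestRemaining b sts) sts ≡ nothing → shift sts ≡ nothing → Sorts (config (N ∷ b) sts out)
  sorts-N-next {sts = []}          0<t _ _  refl _     _    _  _  = contradiction 0<t (n≮n 0)
  sorts-N-next {sts = [] ∷ r}      _   s bc _    _     _    eO eS =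
    step (push (trans (outMove-inInput [] _ bc) eO) eS refl) (sorts-inStack s bc (s≤s z≤n))
  sorts-N-next {sts = (y ∷ s) ∷ r} _   _ _  len  short b≢[] _  eS =
    ⊥-elim (shift-stuck⇒¬ShortPrefix {s = y ∷ s} {r} len eS (λ ()) b≢[] short)

  sorts-inInput : ∀ {t c} a b → 0 < t → Sorts c → input c ≡ a ++ b → Bounded c → length (stacks c) ≡ t →
    ShortPrefix t b c → Sorts (config (a ++ N ∷ b) (stacks c) (output c))
  sorts-inInput {t} {config inp sts out} a b 0<t (finished done) eq _ len _
    with refl , sts≡ ← allOutput⇒emptyStacks inp sts done
    with refl ← ++-conicalˡ a b (sym eq) | refl ← ++-conicalʳ a b (sym eq) =
    subst (λ sts → Sorts (config [ N ] sts out)) (sym sts≡) (sorts-lone-input out (subst (0 <_) (sym len) 0<t))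
  sorts-inInput {t} {config inp sts out} a b 0<t (step m s) eq bc len short with move-inInput a b m eq bc
  ... | inj₁ (a′ , eq′ , m′) =
    step m′ (sorts-inInput a′ b 0<t s eq′ (Bounded-move m bc) (trans (move-length m) len)
                           (Sum.map₁ (subst (_< length b + t) (↭-length (move-↭ m))) short))
  ... | inj₂ (refl , b≢[] , eO , eS) with refl ← eq = sorts-N-next 0<t (step m s) bc len short b≢[] eO eS

IsPerm⇒length : ∀ {n p} → IsPerm n p → length p ≡ n
IsPerm⇒length {n} perm = trans (↭-length perm) (trans (length-map suc (upTo n)) (length-upTo n))

IsPerm⇒bounded : ∀ {n p} → IsPerm n p → All (_< suc n) p
IsPerm⇒bounded {n} perm = All-resp-↭ (↭-sym perm) (map⁺ (All.map s≤s (all-upTo n)))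

mainTheorem5 : (t n : ℕ) → 1 ≤ t → (p : List ℕ) → IsPerm n p →
    GreedySortable t p →
    (j : ℕ) → 1 ≤ j → (j ≤ t ⊎ j ≡ suc n) →
    GreedySortable t (insertAt j (suc n) p)
mainTheorem5 t n 1≤t p perm (fuel , sorted) (suc j) _ position =
  Sorts⇒runGreedy
    (sorts-inInput (take j p) (drop j p) 1≤t (runGreedy⇒Sorts fuel (initConfig t p) sorted)
                   (sym (take++drop≡id j p)) (Bounded-initConfig t (IsPerm⇒bounded perm)) (length-emptyStacks t)
                   (shortPrefix-initConfig p (IsPerm⇒length perm) position))
  where open Largest (suc n)
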